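{- For all integers $n\ge 1$ and $k\ge 1$, $\chi_{la}\big((2k+1)P_2 \vee O_{2n+1}\big) = 3$.
   Context: For a graph $G$ with $q$ edges, a bijection $f:E(G)\to\{1,2,\dots,q\}$ is a local antimagic labeling if $f^+(u)\neq f^+(v)$ for every edge $uv$, where $f^+(u)$ is the sum of $f(e)$ over all edges $e$ incident to $u$. The local antimagic chromatic number $\chi_{la}(G)$ is the minimum, over all local antimagic labelings $f$ of $G$, of the number of distinct values of $f^+$. $O_m$ denotes the null graph on $m$ vertices, $aP_2$ the disjoint union of $a$ copies of $P_2$ (a single edge), and $G\vee H$ the join of $G$ and $H$. -}

module Defs where

open import Data.Nat using (ℕ; zero; suc; _+_; _*_; _≤_)
open import Data.Fin using (Fin; toℕ; _↑ˡ_; _↑ʳ_; splitAt; remQuot; _≟_)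
open import Data.Bool using (Bool; if_then_else_; _∨_)
open import Data.Product using (Σ; _×_; _,_; proj₁; proj₂)
open import Data.Sum using (inj₁; inj₂)
open import Data.List using (List; length; map; deduplicate)
open import Data.List using () renaming (allFin to allFinL)
import Data.Nat as N
open import Relation.Nullary using (¬_)
open import Relation.Nullary.Decidable using (⌊_⌋)
open import Relation.Binary.PropositionalEquality using (_≡_)
open import Function.Definitions using (Bijective)

record Graph : Set where
  field
    V    : ℕ
    q    : ℕ
    ends : Fin q → Fin V × Fin V
open Graph public

copiesP2 : ℕ → Graph
copiesP2 a = record { V = a + a ; q = a ; ends = λ i → (i ↑ˡ a , a ↑ʳ i) }

nullGraph : ℕ → Graph
nullGraph m = record { V = m ; q = 0 ; ends = λ () }

-- G ∨ H : disjoint union plus all edges between V(G) and V(H)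
join : Graph → Graph → Graph
join G H = record
  { V = V G + V H
  ; q = q G + (q H + V G * V H)
  ; ends = e
  }
  where
  e : Fin (q G + (q H + V G * V H)) → Fin (V G + V H) × Fin (V G + V H)
  e x with splitAt (q G) x
  ... | inj₁ a = (proj₁ (ends G a) ↑ˡ V H , proj₂ (ends G a) ↑ˡ V H)
  ... | inj₂ y with splitAt (q H) y
  ...   | inj₁ b = (V G ↑ʳ proj₁ (ends H b) , V G ↑ʳ proj₂ (ends H b))
  ...   | inj₂ p = (proj₁ (remQuot {V G} (V H) p) ↑ˡ V H , V G ↑ʳ proj₂ (remQuot {V G} (V H) p))

sumFin : (n : ℕ) → (Fin n → ℕ) → ℕ
sumFin zero    f = 0
sumFin (suc n) f = f Fin.zero + sumFin n (λ i → f (Fin.suc i))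
  where import Data.Fin as Fin

-- An edge labeling: a bijection E(G) → {1,…,q}, represented as a bijection
-- Fin q → Fin q, the label of e being 1 + toℕ (σ e).
record Labeling (G : Graph) : Set where
  field
    σ     : Fin (q G) → Fin (q G)
    bij   : Bijective _≡_ _≡_ σ
open Labeling public

label : {G : Graph} → Labeling G → Fin (q G) → ℕ
label f e = suc (toℕ (σ f e))

incident : (G : Graph) → Fin (V G) → Fin (q G) → Bool
incident G u e = ⌊ u ≟ proj₁ (ends G e) ⌋ ∨ ⌊ u ≟ proj₂ (ends G e) ⌋

vsum : {G : Graph} → Labeling G → Fin (V G) → ℕ
vsum {G} f u = sumFin (q G) (λ e → if incident G u e then label f e else 0)

IsLocalAntimagic : {G : Graph} → Labeling G → Set
IsLocalAntimagic {G} f =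
  (e : Fin (q G)) → ¬ (vsum f (proj₁ (ends G e)) ≡ vsum f (proj₂ (ends G e)))

distinctSums : {G : Graph} → Labeling G → ℕ
distinctSums {G} f = length (deduplicate N._≟_ (map (vsum f) (allFinL (V G))))

χla≡ : Graph → ℕ → Set
χla≡ G c =
  (Σ (Labeling G) λ f → IsLocalAntimagic f × distinctSums f ≡ c)
  × ((f : Labeling G) → IsLocalAntimagic f → c ≤ distinctSums f)

module Submission where

-- Any local antimagic labelling of (2k+1)P₂ ∨ O_{2n+1} needs three vertex sums, because
-- a matching edge u v together with any vertex w of the null graph spans a triangle.
-- For the upper bound, write a = 2k+1 and m = 2n+1. The u–w edges get the labels 1 … ma,
-- arranged in m columns of a labels each, consecutive columns running in opposite directions.
-- The matching edges get ma+1 … ma+a, and v_i w_j gets the complement Q+1 − f(u_{a−1−i} w_j),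
-- where Q = a + 2am is the number of edges.
-- Each w_j then sees a complementary pairs. Because the columns alternate and m is odd, the
-- u–w labels at u_i add up to a constant minus i, which the matching label ma+1+i
-- compensates. Finally f⁺(u_{a−1−i}) + f⁺(v_i) is constant. So there are only three sums,
-- and they are distinct: the u-sum is below the v-sum, and modulo (Q+1)/2 the w-sum is 0
-- while the other two are ±(n+1)(k+1).

open import Data.Bool using (Bool; true; false; if_then_else_; _∨_)
open import Data.Bool.Properties using (∨-identityʳ)
open import Data.Empty using (⊥-elim)
open import Data.Fin as Fin
  using (Fin; toℕ; fromℕ<; _↑ˡ_; _↑ʳ_; splitAt; combine; remQuot; cast; opposite; punchIn; _≟_)
open import Data.Fin.Permutation using (reverse)
open import Data.Fin.Properties
  using ( punchInᵢ≢i; opposite-prop; opposite-involutive; toℕ<n; toℕ-cast; toℕ-↑ˡ; toℕ-↑ʳ; toℕ-combine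
        ; splitAt-↑ˡ; splitAt-↑ʳ; join-splitAt; remQuot-combine; combine-remQuot; ↑ˡ-injective; ↑ʳ-injective
        ; cast-involutive; +↔⊎; *↔× )
open import Data.List using (List; []; _∷_; _++_; length; map; deduplicate; allFin)
open import Data.List.Membership.Propositional using (_∈_)
open import Data.List.Membership.Propositional.Properties
  using (∈-∃++; ∈-++⁻; ∈-++⁺ˡ; ∈-++⁺ʳ; deduplicate-∈⇔; ∈-map⁺; ∈-map⁻; ∈-allFin)
open import Data.List.Properties using (length-++-sucʳ)
open import Data.List.Relation.Binary.Subset.Propositional using (_⊆_)
open import Data.List.Relation.Unary.All as All using ([]; _∷_)
open import Data.List.Relation.Unary.AllPairs using ([]; _∷_)
open import Data.List.Relation.Unary.Any using (here; there)
open import Data.List.Relation.Unary.Unique.DecPropositional.Properties using (deduplicate-!)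
open import Data.List.Relation.Unary.Unique.Propositional using (Unique)
open import Data.Nat using (ℕ; zero; suc; _+_; _*_; _≤_; _<_; s≤s; z≤n; z<s; >-nonZero; parity)
open import Data.Nat.Divisibility using (_∣_; ∣m+n∣m⇒∣n; ∣⇒≤; n∣m*n)
open import Data.Nat.Properties
  using ( +-*-semiring; <⇒≱; <⇒≢; ≤-antisym; ≤-trans; ≤-reflexive; m≤n+m; m<m+n; m∸n+n≡m
        ; +-identityʳ; *-identityʳ; +-assoc; +-cancelˡ-≡; +-cancelʳ-≡; *-cancelˡ-≡ )
  renaming (_≟_ to _≟ℕ_)
open import Algebra.Properties.Semiring.Sum +-*-semiring
  using (sum; sum-syntax; sum-cong-≗; sum-replicate-zero; sum-remove; ∑-distrib-+; ∑-permute; *-distribˡ-sum)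
open import Data.Nat.Tactic.RingSolver using (solve-∀)
open import Data.Parity.Base using (Parity; 0ℙ; 1ℙ)
open import Data.Product using (_×_; _,_; proj₁; proj₂; uncurry)
open import Data.Product.Function.NonDependent.Propositional using (_×-↔_)
open import Data.Sum as Sum using (_⊎_; inj₁; inj₂)
open import Data.Sum.Function.Propositional using (_⊎-↔_)
open import Function using (_∘_; id)
open import Function.Bundles using (_↔_; mk↔ₛ′; Inverse; Bijection; Equivalence)
open import Function.Construct.Composition using (_↔-∘_)
open import Function.Construct.Identity using (↔-id)
open import Function.Construct.Symmetry using (↔-sym)
open import Function.Definitions using (Injective)
open import Function.Properties.Inverse using (Inverse⇒Bijection)
open import Relation.Binary.PropositionalEquality
open import Relation.Nullary using (Dec; yes; no; ¬_)
open import Relation.Nullary.Decidable using (⌊_⌋; isYes≗does; dec-true; dec-false)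

open import Defs

open ≡-Reasoning

⌊⌋-true : ∀ {A : Set} (a? : Dec A) → A → ⌊ a? ⌋ ≡ true
⌊⌋-true a? a = trans (isYes≗does a?) (dec-true a? a)

⌊⌋-false : ∀ {A : Set} (a? : Dec A) → ¬ A → ⌊ a? ⌋ ≡ false
⌊⌋-false a? ¬a = trans (isYes≗does a?) (dec-false a? ¬a)

toℕ-opposite+suc : ∀ {n} (i : Fin n) → toℕ (opposite i) + suc (toℕ i) ≡ n
toℕ-opposite+suc i = trans (cong (_+ suc (toℕ i)) (opposite-prop i)) (m∸n+n≡m (toℕ<n i))

↑ˡ≢↑ʳ : ∀ {m n} (i : Fin m) (j : Fin n) → i ↑ˡ n ≢ m ↑ʳ j
↑ˡ≢↑ʳ {m} {n} i j eq with trans (sym (splitAt-↑ˡ m i n)) (trans (cong (splitAt m) eq) (splitAt-↑ʳ m n j))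
... | ()

≟-injective : ∀ {m n} {φ : Fin m → Fin n} → Injective _≡_ _≡_ φ → ∀ i j → ⌊ φ i ≟ φ j ⌋ ≡ ⌊ i ≟ j ⌋
≟-injective {φ = φ} φ-injective i j with i ≟ j
... | yes refl = ⌊⌋-true (φ i ≟ φ i) refl
... | no i≢j   = ⌊⌋-false (φ i ≟ φ j) (i≢j ∘ φ-injective)

≟-↑ˡ : ∀ {m} n (i j : Fin m) → ⌊ i ↑ˡ n ≟ j ↑ˡ n ⌋ ≡ ⌊ i ≟ j ⌋
≟-↑ˡ n = ≟-injective (↑ˡ-injective n _ _)

≟-↑ʳ : ∀ m {n} (i j : Fin n) → ⌊ m ↑ʳ i ≟ m ↑ʳ j ⌋ ≡ ⌊ i ≟ j ⌋
≟-↑ʳ m = ≟-injective (↑ʳ-injective m _ _)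

≟-↑ˡ↑ʳ : ∀ {m n} (i : Fin m) (j : Fin n) → ⌊ i ↑ˡ n ≟ m ↑ʳ j ⌋ ≡ false
≟-↑ˡ↑ʳ i j = ⌊⌋-false (i ↑ˡ _ ≟ _ ↑ʳ j) (↑ˡ≢↑ʳ i j)

≟-↑ʳ↑ˡ : ∀ {m n} (i : Fin m) (j : Fin n) → ⌊ m ↑ʳ j ≟ i ↑ˡ n ⌋ ≡ false
≟-↑ʳ↑ˡ i j = ⌊⌋-false (_ ↑ʳ j ≟ i ↑ˡ _) (↑ˡ≢↑ʳ i j ∘ sym)

↑-elim : ∀ {m n} (P : Fin (m + n) → Set) → (∀ i → P (i ↑ˡ n)) → (∀ j → P (m ↑ʳ j)) → ∀ x → P x
↑-elim {m} {n} P left right x =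
  subst P (join-splitAt m n x) (Sum.[_,_] {C = P ∘ Fin.join m n} left right (splitAt m x))

combine-elim : ∀ {m n} (P : Fin (m * n) → Set) → (∀ i j → P (combine i j)) → ∀ x → P x
combine-elim {m} {n} P both x =
  subst P (combine-remQuot {m} n x) (both (proj₁ (remQuot {m} n x)) (proj₂ (remQuot {m} n x)))

cast↔ : ∀ {m n} → m ≡ n → Fin m ↔ Fin n
cast↔ eq = mk↔ₛ′ (cast eq) (cast (sym eq)) (cast-involutive eq (sym eq)) (cast-involutive (sym eq) eq)

sumFin≡sum : ∀ n (f : Fin n → ℕ) → sumFin n f ≡ sum f
sumFin≡sum zero    f = refl
sumFin≡sum (suc n) f = cong (f Fin.zero +_) (sumFin≡sum n (λ i → f (Fin.suc i)))

∑-zero : ∀ {n} {f : Fin n → ℕ} → (∀ i → f i ≡ 0) → sum f ≡ 0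
∑-zero {n} f≡0 = trans (sum-cong-≗ f≡0) (sum-replicate-zero n)

∑-const : ∀ n c → ∑[ i < n ] c ≡ n * c
∑-const zero    c = refl
∑-const (suc n) c = cong (c +_) (∑-const n c)

∑-↑ : ∀ p r (f : Fin (p + r) → ℕ) → sum f ≡ ∑[ i < p ] f (i ↑ˡ r) + ∑[ j < r ] f (p ↑ʳ j)
∑-↑ zero    r f = refl
∑-↑ (suc p) r f = trans (cong (f Fin.zero +_) (∑-↑ p r (λ i → f (Fin.suc i))))
                        (sym (+-assoc (f Fin.zero) _ _))

∑-combine : ∀ p r (f : Fin (p * r) → ℕ) → sum f ≡ ∑[ i < p ] ∑[ j < r ] f (combine i j)
∑-combine zero    r f = refl
∑-combine (suc p) r f =
  trans (∑-↑ r (p * r) f) (cong (∑[ j < r ] f (j ↑ˡ (p * r)) +_) (∑-combine p r (λ y → f (r ↑ʳ y))))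

∑-if : ∀ {n} b (f : Fin n → ℕ) → ∑[ i < n ] (if b then f i else 0) ≡ (if b then sum f else 0)
∑-if     true  f = refl
∑-if {n} false f = ∑-zero {n} (λ _ → refl)

∑-if-≟ : ∀ {n} (i₀ : Fin n) (f : Fin n → ℕ) → ∑[ i < n ] (if ⌊ i₀ ≟ i ⌋ then f i else 0) ≡ f i₀
∑-if-≟ {suc n} i₀ f = begin
  sum g                               ≡⟨ sum-remove {i = i₀} g ⟩
  g i₀ + sum (λ j → g (punchIn i₀ j)) ≡⟨ cong₂ _+_ g[i₀] (∑-zero g[punchIn]) ⟩
  f i₀ + 0                            ≡⟨ +-identityʳ (f i₀) ⟩
  f i₀                                ∎
  where
  g : Fin (suc n) → ℕ
  g i = if ⌊ i₀ ≟ i ⌋ then f i else 0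
  g[i₀] : g i₀ ≡ f i₀
  g[i₀] rewrite ⌊⌋-true (i₀ ≟ i₀) refl = refl
  g[punchIn] : ∀ j → g (punchIn i₀ j) ≡ 0
  g[punchIn] j rewrite ⌊⌋-false (i₀ ≟ punchIn i₀ j) (punchInᵢ≢i i₀ j ∘ sym) = refl

∑-opposite : ∀ {n} (f : Fin n → ℕ) → ∑[ i < n ] f (opposite i) ≡ sum f
∑-opposite f = sym (∑-permute f reverse)

∑-toℕ : ∀ N → 2 * ∑[ j < N ] toℕ j + N ≡ N * N
∑-toℕ zero    = refl
∑-toℕ (suc N) = begin
  2 * ∑[ j < N ] (1 + toℕ j) + suc N  ≡⟨ cong (λ s → 2 * s + suc N) (∑-distrib-+ {N} (λ _ → 1) toℕ) ⟩
  2 * (∑[ j < N ] 1 + S) + suc N      ≡⟨ cong (λ c → 2 * (c + S) + suc N) (∑-const N 1) ⟩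
  2 * (N * 1 + S) + suc N             ≡⟨ regroup N S ⟩
  (2 * S + N) + (2 * N + 1)           ≡⟨ cong (_+ (2 * N + 1)) (∑-toℕ N) ⟩
  N * N + (2 * N + 1)                 ≡⟨ square N ⟩
  suc N * suc N                       ∎
  where
  S : ℕ
  S = ∑[ j < N ] toℕ j
  regroup : ∀ N S → 2 * (N * 1 + S) + suc N ≡ (2 * S + N) + (2 * N + 1)
  regroup = solve-∀
  square : ∀ N → N * N + (2 * N + 1) ≡ suc N * suc N
  square = solve-∀

∑-toℕ-odd : ∀ n → ∑[ j < 2 * n + 1 ] toℕ j ≡ n * (2 * n + 1)
∑-toℕ-odd n = *-cancelˡ-≡ _ _ 2 (+-cancelʳ-≡ m _ _ (trans (∑-toℕ m) (square n)))
  where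
  m : ℕ
  m = 2 * n + 1
  square : ∀ n → (2 * n + 1) * (2 * n + 1) ≡ 2 * (n * (2 * n + 1)) + (2 * n + 1)
  square = solve-∀

∑-parity : ∀ n (g : Parity → ℕ) → ∑[ j < 2 * n + 1 ] g (parity (toℕ j)) ≡ suc n * g 0ℙ + n * g 1ℙ
∑-parity n g = trans (cong (λ N → ∑[ j < N ] g (parity (toℕ j))) (odd n)) (go n)
  where
  odd : ∀ n → 2 * n + 1 ≡ suc (n * 2)
  odd = solve-∀
  step : ∀ n x y → x + (y + (suc n * x + n * y)) ≡ suc (suc n) * x + suc n * y
  step = solve-∀
  go : ∀ n → ∑[ j < suc (n * 2) ] g (parity (toℕ j)) ≡ suc n * g 0ℙ + n * g 1ℙ
  go zero    = cong (_+ 0) (sym (+-identityʳ (g 0ℙ)))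
  go (suc n) = trans (cong (λ s → g 0ℙ + (g 1ℙ + s)) (go n)) (step n (g 0ℙ) (g 1ℙ))

Unique-⊆⇒length≤ : ∀ {A : Set} {xs ys : List A} → Unique xs → xs ⊆ ys → length xs ≤ length ys
Unique-⊆⇒length≤ {xs = []}     _           _  = z≤n
Unique-⊆⇒length≤ {xs = x ∷ xs} (x∉xs ∷ u) xs⊆ys with ∈-∃++ (xs⊆ys (here refl))
... | ys₁ , ys₂ , refl =
  ≤-trans (s≤s (Unique-⊆⇒length≤ u xs⊆ys₁++ys₂)) (≤-reflexive (sym (length-++-sucʳ ys₁ x ys₂)))
  where
  xs⊆ys₁++ys₂ : xs ⊆ ys₁ ++ ys₂
  xs⊆ys₁++ys₂ z∈xs with ∈-++⁻ ys₁ (xs⊆ys (there z∈xs))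
  ... | inj₁ z∈ys₁         = ∈-++⁺ˡ z∈ys₁
  ... | inj₂ (here refl)   = ⊥-elim (All.lookup x∉xs z∈xs refl)
  ... | inj₂ (there z∈ys₂) = ∈-++⁺ʳ ys₁ z∈ys₂

length≤length-deduplicate : ∀ {xs ys : List ℕ} → Unique ys → ys ⊆ xs →
                            length ys ≤ length (deduplicate _≟ℕ_ xs)
length≤length-deduplicate u ys⊆xs = Unique-⊆⇒length≤ u (Equivalence.to (deduplicate-∈⇔ _≟ℕ_) ∘ ys⊆xs)

length-deduplicate≤length : ∀ {xs ys : List ℕ} → xs ⊆ ys → length (deduplicate _≟ℕ_ xs) ≤ length ys
length-deduplicate≤length {xs} xs⊆ys =
  Unique-⊆⇒length≤ (deduplicate-! _≟ℕ_ xs) (xs⊆ys ∘ Equivalence.from (deduplicate-∈⇔ _≟ℕ_))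

adjacent-vsum-≢ : ∀ {G} (f : Labeling G) → IsLocalAntimagic f →
                  ∀ {e x y} → ends G e ≡ (x , y) → vsum f x ≢ vsum f y
adjacent-vsum-≢ f antimagic {e} ends≡ = subst (λ (x , y) → vsum f x ≢ vsum f y) ends≡ (antimagic e)

antimagic-at : ∀ {G} (f : Labeling G) {e x y} → ends G e ≡ (x , y) → vsum f x ≢ vsum f y →
               ¬ vsum f (proj₁ (ends G e)) ≡ vsum f (proj₂ (ends G e))
antimagic-at f ends≡ = subst (λ (x , y) → vsum f x ≢ vsum f y) (sym ends≡)

triangle⇒3≤distinctSums : ∀ {G} (f : Labeling G) → IsLocalAntimagic f →
                     ∀ {e₁ e₂ e₃ x y z} → ends G e₁ ≡ (x , y) → ends G e₂ ≡ (x , z) → ends G e₃ ≡ (y , z) →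
                     3 ≤ distinctSums f
triangle⇒3≤distinctSums {G} f antimagic {x = x} {y} {z} xy xz yz = length≤length-deduplicate unique triangle⊆
  where
  unique : Unique (vsum f x ∷ vsum f y ∷ vsum f z ∷ [])
  unique = (adjacent-vsum-≢ f antimagic xy ∷ adjacent-vsum-≢ f antimagic xz ∷ [])
         ∷ (adjacent-vsum-≢ f antimagic yz ∷ []) ∷ [] ∷ []
  triangle⊆ : vsum f x ∷ vsum f y ∷ vsum f z ∷ [] ⊆ map (vsum f) (allFin (V G))
  triangle⊆ (here refl)                 = ∈-map⁺ (vsum f) (∈-allFin x)
  triangle⊆ (there (here refl))         = ∈-map⁺ (vsum f) (∈-allFin y)
  triangle⊆ (there (there (here refl))) = ∈-map⁺ (vsum f) (∈-allFin z)

distinctSums≤length : ∀ {G} (f : Labeling G) {ys} → (∀ x → vsum f x ∈ ys) → distinctSums f ≤ length ys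
distinctSums≤length f {ys} vsum∈ys = length-deduplicate≤length sums⊆ys
  where
  sums⊆ys : map (vsum f) (allFin _) ⊆ ys
  sums⊆ys s∈ with ∈-map⁻ (vsum f) s∈
  ... | x , _ , refl = vsum∈ys x

isEndpoint : ∀ {n} → Fin n → Fin n × Fin n → Bool
isEndpoint u (x , y) = ⌊ u ≟ x ⌋ ∨ ⌊ u ≟ y ⌋

incidentWeight : (G : Graph) → (Fin (q G) → ℕ) → Fin (V G) → Fin (q G) → ℕ
incidentWeight G w u e = if incident G u e then w e else 0

incidentSum : (G : Graph) → (Fin (q G) → ℕ) → Fin (V G) → ℕ
incidentSum G w u = ∑[ e < q G ] incidentWeight G w u e

vsum≡incidentSum : ∀ {G} (f : Labeling G) u → vsum f u ≡ incidentSum G (label f) u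
vsum≡incidentSum {G} f u = sumFin≡sum (q G) _

module Join (G H : Graph) where

  leftEdge : Fin (q G) → Fin (q (join G H))
  leftEdge e = e ↑ˡ (q H + V G * V H)

  rightEdge : Fin (q H) → Fin (q (join G H))
  rightEdge e = q G ↑ʳ (e ↑ˡ V G * V H)

  crossEdge : Fin (V G) → Fin (V H) → Fin (q (join G H))
  crossEdge x y = q G ↑ʳ (q H ↑ʳ combine x y)

  ends-leftEdge : ∀ e → ends (join G H) (leftEdge e) ≡ (proj₁ (ends G e) ↑ˡ V H , proj₂ (ends G e) ↑ˡ V H)
  ends-leftEdge e rewrite splitAt-↑ˡ (q G) e (q H + V G * V H) = refl

  ends-rightEdge : ∀ e → ends (join G H) (rightEdge e) ≡ (V G ↑ʳ proj₁ (ends H e) , V G ↑ʳ proj₂ (ends H e))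
  ends-rightEdge e rewrite splitAt-↑ʳ (q G) (q H + V G * V H) (e ↑ˡ V G * V H)
                         | splitAt-↑ˡ (q H) e (V G * V H) = refl

  ends-crossEdge : ∀ x y → ends (join G H) (crossEdge x y) ≡ (x ↑ˡ V H , V G ↑ʳ y)
  ends-crossEdge x y rewrite splitAt-↑ʳ (q G) (q H + V G * V H) (q H ↑ʳ combine x y)
                           | splitAt-↑ʳ (q H) (V G * V H) (combine x y) =
    cong (λ (x′ , y′) → (x′ ↑ˡ V H , V G ↑ʳ y′)) (remQuot-combine x y)

  incidentSum-join : ∀ w u → incidentSum (join G H) w u ≡
    ∑[ e < q G ] incidentWeight (join G H) w u (leftEdge e)
    + (∑[ e < q H ] incidentWeight (join G H) w u (rightEdge e)
       + ∑[ x < V G ] ∑[ y < V H ] incidentWeight (join G H) w u (crossEdge x y))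
  incidentSum-join w u =
    trans (∑-↑ (q G) _ h)
          (cong (∑[ e < q G ] h (leftEdge e) +_)
                (trans (∑-↑ (q H) _ (λ t → h (q G ↑ʳ t)))
                       (cong (∑[ e < q H ] h (rightEdge e) +_) (∑-combine (V G) (V H) _))))
    where
    h : Fin (q (join G H)) → ℕ
    h = incidentWeight (join G H) w u

  incident-↑ˡ-leftEdge : ∀ x e → incident (join G H) (x ↑ˡ V H) (leftEdge e) ≡ incident G x e
  incident-↑ˡ-leftEdge x e = trans (cong (isEndpoint (x ↑ˡ V H)) (ends-leftEdge e))
                                   (cong₂ _∨_ (≟-↑ˡ (V H) x _) (≟-↑ˡ (V H) x _))

  incident-↑ˡ-rightEdge : ∀ x e → incident (join G H) (x ↑ˡ V H) (rightEdge e) ≡ false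
  incident-↑ˡ-rightEdge x e = trans (cong (isEndpoint (x ↑ˡ V H)) (ends-rightEdge e))
                                    (cong₂ _∨_ (≟-↑ˡ↑ʳ x _) (≟-↑ˡ↑ʳ x _))

  incident-↑ˡ-crossEdge : ∀ x x′ y → incident (join G H) (x ↑ˡ V H) (crossEdge x′ y) ≡ ⌊ x ≟ x′ ⌋
  incident-↑ˡ-crossEdge x x′ y = trans (cong (isEndpoint (x ↑ˡ V H)) (ends-crossEdge x′ y))
                                       (trans (cong₂ _∨_ (≟-↑ˡ (V H) x x′) (≟-↑ˡ↑ʳ x y)) (∨-identityʳ _))

  incident-↑ʳ-leftEdge : ∀ y e → incident (join G H) (V G ↑ʳ y) (leftEdge e) ≡ false
  incident-↑ʳ-leftEdge y e = trans (cong (isEndpoint (V G ↑ʳ y)) (ends-leftEdge e))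
                                   (cong₂ _∨_ (≟-↑ʳ↑ˡ (proj₁ (ends G e)) y) (≟-↑ʳ↑ˡ (proj₂ (ends G e)) y))

  incident-↑ʳ-rightEdge : ∀ y e → incident (join G H) (V G ↑ʳ y) (rightEdge e) ≡ incident H y e
  incident-↑ʳ-rightEdge y e = trans (cong (isEndpoint (V G ↑ʳ y)) (ends-rightEdge e))
                                    (cong₂ _∨_ (≟-↑ʳ (V G) y _) (≟-↑ʳ (V G) y _))

  incident-↑ʳ-crossEdge : ∀ y x y′ → incident (join G H) (V G ↑ʳ y) (crossEdge x y′) ≡ ⌊ y ≟ y′ ⌋
  incident-↑ʳ-crossEdge y x y′ = trans (cong (isEndpoint (V G ↑ʳ y)) (ends-crossEdge x y′))
                                       (cong₂ _∨_ (≟-↑ʳ↑ˡ x y) (≟-↑ʳ (V G) y y′))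

  incidentSum-↑ˡ : ∀ w x → incidentSum (join G H) w (x ↑ˡ V H) ≡
                   incidentSum G (w ∘ leftEdge) x + ∑[ y < V H ] w (crossEdge x y)
  incidentSum-↑ˡ w x = begin
    incidentSum (join G H) w (x ↑ˡ V H)
      ≡⟨ incidentSum-join w (x ↑ˡ V H) ⟩
    ∑[ e < q G ] h (leftEdge e) + (∑[ e < q H ] h (rightEdge e) + ∑[ x′ < V G ] ∑[ y < V H ] h (crossEdge x′ y))
      ≡⟨ cong₂ _+_ (sum-cong-≗ left) (cong₂ _+_ (∑-zero {q H} right) (sum-cong-≗ cross)) ⟩
    incidentSum G (w ∘ leftEdge) x + ∑[ x′ < V G ] (if ⌊ x ≟ x′ ⌋ then ∑[ y < V H ] w (crossEdge x′ y) else 0)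
      ≡⟨ cong (incidentSum G (w ∘ leftEdge) x +_) (∑-if-≟ x _) ⟩
    incidentSum G (w ∘ leftEdge) x + ∑[ y < V H ] w (crossEdge x y) ∎
    where
    h : Fin (q (join G H)) → ℕ
    h = incidentWeight (join G H) w (x ↑ˡ V H)
    left : ∀ e → h (leftEdge e) ≡ incidentWeight G (w ∘ leftEdge) x e
    left e = cong (λ b → if b then w (leftEdge e) else 0) (incident-↑ˡ-leftEdge x e)
    right : ∀ e → h (rightEdge e) ≡ 0
    right e = cong (λ b → if b then w (rightEdge e) else 0) (incident-↑ˡ-rightEdge x e)
    cross : ∀ x′ → ∑[ y < V H ] h (crossEdge x′ y) ≡ (if ⌊ x ≟ x′ ⌋ then ∑[ y < V H ] w (crossEdge x′ y) else 0)
    cross x′ = trans (sum-cong-≗ (λ y → cong (λ b → if b then w (crossEdge x′ y) else 0)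
                                             (incident-↑ˡ-crossEdge x x′ y)))
                     (∑-if ⌊ x ≟ x′ ⌋ (w ∘ crossEdge x′))

  incidentSum-↑ʳ : ∀ w y → incidentSum (join G H) w (V G ↑ʳ y) ≡
                   incidentSum H (w ∘ rightEdge) y + ∑[ x < V G ] w (crossEdge x y)
  incidentSum-↑ʳ w y = begin
    incidentSum (join G H) w (V G ↑ʳ y)
      ≡⟨ incidentSum-join w (V G ↑ʳ y) ⟩
    ∑[ e < q G ] h (leftEdge e) + (∑[ e < q H ] h (rightEdge e) + ∑[ x < V G ] ∑[ y′ < V H ] h (crossEdge x y′))
      ≡⟨ cong₂ _+_ (∑-zero {q G} left) (cong₂ _+_ (sum-cong-≗ right) (sum-cong-≗ cross)) ⟩
    incidentSum H (w ∘ rightEdge) y + ∑[ x < V G ] w (crossEdge x y) ∎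
    where
    h : Fin (q (join G H)) → ℕ
    h = incidentWeight (join G H) w (V G ↑ʳ y)
    left : ∀ e → h (leftEdge e) ≡ 0
    left e = cong (λ b → if b then w (leftEdge e) else 0) (incident-↑ʳ-leftEdge y e)
    right : ∀ e → h (rightEdge e) ≡ incidentWeight H (w ∘ rightEdge) y e
    right e = cong (λ b → if b then w (rightEdge e) else 0) (incident-↑ʳ-rightEdge y e)
    cross : ∀ x → ∑[ y′ < V H ] h (crossEdge x y′) ≡ w (crossEdge x y)
    cross x = trans (sum-cong-≗ (λ y′ → cong (λ b → if b then w (crossEdge x y′) else 0)
                                             (incident-↑ʳ-crossEdge y x y′)))
                    (∑-if-≟ y (w ∘ crossEdge x))

incidentSum-copiesP2-↑ˡ : ∀ a w (i : Fin a) → incidentSum (copiesP2 a) w (i ↑ˡ a) ≡ w i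
incidentSum-copiesP2-↑ˡ a w i = trans (sum-cong-≗ incidence) (∑-if-≟ i w)
  where
  incidence : ∀ e → incidentWeight (copiesP2 a) w (i ↑ˡ a) e ≡ (if ⌊ i ≟ e ⌋ then w e else 0)
  incidence e = cong (λ b → if b then w e else 0)
                     (trans (cong₂ _∨_ (≟-↑ˡ a i e) (≟-↑ˡ↑ʳ i e)) (∨-identityʳ _))

incidentSum-copiesP2-↑ʳ : ∀ a w (i : Fin a) → incidentSum (copiesP2 a) w (a ↑ʳ i) ≡ w i
incidentSum-copiesP2-↑ʳ a w i = trans (sum-cong-≗ incidence) (∑-if-≟ i w)
  where
  incidence : ∀ e → incidentWeight (copiesP2 a) w (a ↑ʳ i) e ≡ (if ⌊ i ≟ e ⌋ then w e else 0)
  incidence e = cong (λ b → if b then w e else 0) (cong₂ _∨_ (≟-↑ʳ↑ˡ e i) (≟-↑ʳ a i e))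

module MatchingJoinNull (a m : ℕ) where

  G : Graph
  G = join (copiesP2 a) (nullGraph m)

  open Join (copiesP2 a) (nullGraph m)

  u v : Fin a → Fin (V G)
  u i = (i ↑ˡ a) ↑ˡ m
  v i = (a ↑ʳ i) ↑ˡ m

  w : Fin m → Fin (V G)
  w j = (a + a) ↑ʳ j

  matchEdge : Fin a → Fin (q G)
  matchEdge = leftEdge

  uwEdge vwEdge : Fin a → Fin m → Fin (q G)
  uwEdge i = crossEdge (i ↑ˡ a)
  vwEdge i = crossEdge (a ↑ʳ i)

  vertex-elim : (P : Fin (V G) → Set) → (∀ i → P (u i)) → (∀ i → P (v i)) → (∀ j → P (w j)) → ∀ x → P x
  vertex-elim P Pu Pv = ↑-elim {a + a} P (↑-elim (P ∘ (_↑ˡ m)) Pu Pv)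

  edge-elim : (P : Fin (q G) → Set) →
              (∀ i → P (matchEdge i)) → (∀ i j → P (uwEdge i j)) → (∀ i j → P (vwEdge i j)) → ∀ e → P e
  edge-elim P Pmatch Puw Pvw =
    ↑-elim {a} P Pmatch
      (combine-elim {a + a} {m} (P ∘ (a ↑ʳ_)) (↑-elim (λ r → ∀ j → P (crossEdge r j)) Puw Pvw))

  ends-matchEdge : ∀ i → ends G (matchEdge i) ≡ (u i , v i)
  ends-matchEdge = ends-leftEdge

  ends-uwEdge : ∀ i j → ends G (uwEdge i j) ≡ (u i , w j)
  ends-uwEdge i = ends-crossEdge (i ↑ˡ a)

  ends-vwEdge : ∀ i j → ends G (vwEdge i j) ≡ (v i , w j)
  ends-vwEdge i = ends-crossEdge (a ↑ʳ i)

  3≤distinctSums : Fin a → Fin m → (f : Labeling G) → IsLocalAntimagic f → 3 ≤ distinctSums f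
  3≤distinctSums i j f antimagic =
    triangle⇒3≤distinctSums f antimagic (ends-matchEdge i) (ends-uwEdge i j) (ends-vwEdge i j)

  module _ (f : Labeling G) where

    vsum-u : ∀ i → vsum f (u i) ≡ label f (matchEdge i) + ∑[ j < m ] label f (uwEdge i j)
    vsum-u i = trans (vsum≡incidentSum f (u i))
                     (trans (incidentSum-↑ˡ (label f) (i ↑ˡ a))
                            (cong (_+ ∑[ j < m ] label f (uwEdge i j))
                                  (incidentSum-copiesP2-↑ˡ a (label f ∘ leftEdge) i)))

    vsum-v : ∀ i → vsum f (v i) ≡ label f (matchEdge i) + ∑[ j < m ] label f (vwEdge i j)
    vsum-v i = trans (vsum≡incidentSum f (v i))
                     (trans (incidentSum-↑ˡ (label f) (a ↑ʳ i))
                            (cong (_+ ∑[ j < m ] label f (vwEdge i j))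
                                  (incidentSum-copiesP2-↑ʳ a (label f ∘ leftEdge) i)))

    vsum-w : ∀ j → vsum f (w j) ≡ ∑[ i < a ] label f (uwEdge i j) + ∑[ i < a ] label f (vwEdge i j)
    vsum-w j = trans (vsum≡incidentSum f (w j))
                     (trans (incidentSum-↑ʳ (label f) j) (∑-↑ a a (λ r → label f (crossEdge r j))))

uSum vSum wSum : ℕ → ℕ → ℕ
uSum a n = suc n * (2 * (a * suc n) + 1)
vSum a n = suc n * (2 * (a * (3 * n + 2)) + 1)
wSum a n = a * suc (a + (a + a) * (2 * n + 1))

m*d+r≢n*d : ∀ x y {d r} → 0 < r → r < d → x * d + r ≢ y * d
m*d+r≢n*d x y {d} 0<r r<d eq =
  <⇒≱ r<d (∣⇒≤ {{>-nonZero 0<r}} (∣m+n∣m⇒∣n (subst (d ∣_) (sym eq) (n∣m*n y)) (n∣m*n x)))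

module _ (k n : ℕ) where

  -- D = (Q + 1) / 2 for a = 2k + 1. Modulo D the three sums are r, −r and 0, and 0 < r < D.
  private
    a D r : ℕ
    a = 2 * k + 1
    D = suc (4 * k * n + 3 * k + 2 * n + 1)
    r = suc n * suc k

    r<D : r < D
    r<D = subst (r <_) (sym (split k n)) (m<m+n r z<s)
      where
      split : ∀ k n → suc (4 * k * n + 3 * k + 2 * n + 1) ≡ suc n * suc k + suc (3 * k * n + 2 * k + n)
      split = solve-∀

    uSum≡ : uSum a n ≡ suc n * D + r
    uSum≡ = identity k n
      where
      identity : ∀ k n → suc n * (2 * ((2 * k + 1) * suc n) + 1)
                         ≡ suc n * suc (4 * k * n + 3 * k + 2 * n + 1) + suc n * suc k
      identity = solve-∀

    vSum+r≡ : vSum a n + r ≡ 3 * suc n * D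
    vSum+r≡ = identity k n
      where
      identity : ∀ k n → suc n * (2 * ((2 * k + 1) * (3 * n + 2)) + 1) + suc n * suc k
                         ≡ 3 * suc n * suc (4 * k * n + 3 * k + 2 * n + 1)
      identity = solve-∀

    wSum≡ : wSum a n ≡ 2 * a * D
    wSum≡ = identity k n
      where
      identity : ∀ k n → (2 * k + 1) * suc ((2 * k + 1) + ((2 * k + 1) + (2 * k + 1)) * (2 * n + 1))
                         ≡ 2 * (2 * k + 1) * suc (4 * k * n + 3 * k + 2 * n + 1)
      identity = solve-∀

  uSum<vSum : uSum (2 * k + 1) n < vSum (2 * k + 1) n
  uSum<vSum = subst (uSum a n <_) (sym (gap k n)) (m<m+n (uSum a n) z<s)
    where
    gap : ∀ k n → suc n * (2 * ((2 * k + 1) * (3 * n + 2)) + 1)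
                ≡ suc n * (2 * ((2 * k + 1) * suc n) + 1) + 2 * (suc n * suc (2 * k) * suc (2 * n))
    gap = solve-∀

  uSum≢wSum : uSum (2 * k + 1) n ≢ wSum (2 * k + 1) n
  uSum≢wSum eq = m*d+r≢n*d (suc n) (2 * a) z<s r<D (trans (sym uSum≡) (trans eq wSum≡))

  vSum≢wSum : vSum (2 * k + 1) n ≢ wSum (2 * k + 1) n
  vSum≢wSum eq =
    m*d+r≢n*d (2 * a) (3 * suc n) z<s r<D (trans (cong (_+ r) (trans (sym wSum≡) (sym eq))) vSum+r≡)


module Labelling (a n : ℕ) where

  m : ℕ
  m = 2 * n + 1

  open MatchingJoinNull a m

  Q : ℕ
  Q = q G

  -- Consecutive columns run in opposite directions; as m is odd, this makes the row sums
  -- drop by exactly one from each row to the next (∑-column).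
  twist : Parity → Fin a → Fin a
  twist 0ℙ = opposite
  twist 1ℙ = id

  twist-involutive : ∀ p x → twist p (twist p x) ≡ x
  twist-involutive 0ℙ = opposite-involutive
  twist-involutive 1ℙ x = refl

  column : Fin a → Fin m → Fin (m * a)
  column i j = combine j (twist (parity (toℕ j)) i)

  column⁻¹ : Fin (m * a) → Fin a × Fin m
  column⁻¹ c = let (j , x) = remQuot {m} a c in twist (parity (toℕ j)) x , j

  column-column⁻¹ : ∀ c → uncurry column (column⁻¹ c) ≡ c
  column-column⁻¹ c = trans (cong (combine j) (twist-involutive (parity (toℕ j)) x)) (combine-remQuot {m} a c)
    where
    j : Fin m
    j = proj₁ (remQuot {m} a c)
    x : Fin a
    x = proj₂ (remQuot {m} a c)

  column⁻¹-column : ∀ i j → column⁻¹ (column i j) ≡ (i , j)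
  column⁻¹-column i j =
    trans (cong (λ (j′ , x) → twist (parity (toℕ j′)) x , j′) (remQuot-combine j (twist (parity (toℕ j)) i)))
          (cong (_, j) (twist-involutive (parity (toℕ j)) i))

  EdgeKind LabelRange : Set
  EdgeKind   = Fin a ⊎ ((Fin a ⊎ Fin a) × Fin m)
  LabelRange = Fin (m * a) ⊎ (Fin a ⊎ Fin (m * a))

  edgeKinds : EdgeKind ↔ Fin Q
  edgeKinds = ↔-sym +↔⊎ ↔-∘ (↔-id (Fin a) ⊎-↔ (↔-sym *↔× ↔-∘ (↔-sym +↔⊎ ×-↔ ↔-id (Fin m))))

  Q≡ : m * a + (a + m * a) ≡ Q
  Q≡ = size m a
    where
    size : ∀ m a → m * a + (a + m * a) ≡ a + (a + a) * m
    size = solve-∀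

  labelRanges : LabelRange ↔ Fin Q
  labelRanges = cast↔ Q≡ ↔-∘ (↔-sym +↔⊎ ↔-∘ (↔-id (Fin (m * a)) ⊎-↔ ↔-sym +↔⊎))

  rangeValue : LabelRange → ℕ
  rangeValue (inj₁ c)        = toℕ c
  rangeValue (inj₂ (inj₁ i)) = m * a + toℕ i
  rangeValue (inj₂ (inj₂ c)) = m * a + (a + toℕ c)

  toℕ-labelRanges : ∀ r → toℕ (Inverse.to labelRanges r) ≡ rangeValue r
  toℕ-labelRanges (inj₁ c)        = trans (toℕ-cast Q≡ _) (toℕ-↑ˡ c _)
  toℕ-labelRanges (inj₂ (inj₁ i)) =
    trans (toℕ-cast Q≡ _) (trans (toℕ-↑ʳ (m * a) _) (cong (m * a +_) (toℕ-↑ˡ i _)))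
  toℕ-labelRanges (inj₂ (inj₂ c)) =
    trans (toℕ-cast Q≡ _) (trans (toℕ-↑ʳ (m * a) _) (cong (m * a +_) (toℕ-↑ʳ a c)))

  assign : EdgeKind → LabelRange
  assign (inj₁ i)            = inj₂ (inj₁ i)
  assign (inj₂ (inj₁ i , j)) = inj₁ (column i j)
  assign (inj₂ (inj₂ i , j)) = inj₂ (inj₂ (opposite (column (opposite i) j)))

  assign⁻¹ : LabelRange → EdgeKind
  assign⁻¹ (inj₁ c)        = let (i , j) = column⁻¹ c in inj₂ (inj₁ i , j)
  assign⁻¹ (inj₂ (inj₁ i)) = inj₁ i
  assign⁻¹ (inj₂ (inj₂ c)) = let (i , j) = column⁻¹ (opposite c) in inj₂ (inj₂ (opposite i) , j)

  assign↔ : EdgeKind ↔ LabelRange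
  assign↔ = mk↔ₛ′ assign assign⁻¹ assign-assign⁻¹ assign⁻¹-assign
    where
    assign-assign⁻¹ : ∀ r → assign (assign⁻¹ r) ≡ r
    assign-assign⁻¹ (inj₁ c)        = cong inj₁ (column-column⁻¹ c)
    assign-assign⁻¹ (inj₂ (inj₁ i)) = refl
    assign-assign⁻¹ (inj₂ (inj₂ c)) =
      cong (inj₂ ∘ inj₂)
           (trans (cong (λ i → opposite (column i (proj₂ (column⁻¹ (opposite c))))) (opposite-involutive _))
                  (trans (cong opposite (column-column⁻¹ (opposite c))) (opposite-involutive c)))
    assign⁻¹-assign : ∀ k → assign⁻¹ (assign k) ≡ k
    assign⁻¹-assign (inj₁ i)            = refl
    assign⁻¹-assign (inj₂ (inj₁ i , j)) = cong (λ (i , j) → inj₂ (inj₁ i , j)) (column⁻¹-column i j)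
    assign⁻¹-assign (inj₂ (inj₂ i , j)) =
      trans (cong (λ c → let (i′ , j′) = column⁻¹ c in inj₂ (inj₂ (opposite i′) , j′)) (opposite-involutive _))
            (trans (cong (λ (i′ , j′) → inj₂ (inj₂ (opposite i′) , j′)) (column⁻¹-column (opposite i) j))
                   (cong (λ i′ → inj₂ (inj₂ i′ , j)) (opposite-involutive i)))

  labelling↔ : Fin Q ↔ Fin Q
  labelling↔ = labelRanges ↔-∘ (assign↔ ↔-∘ ↔-sym edgeKinds)

  labelling : Labeling G
  labelling = record { σ = Inverse.to labelling↔ ; bij = Bijection.bijective (Inverse⇒Bijection labelling↔) }

  label-edgeKinds : ∀ k → label labelling (Inverse.to edgeKinds k) ≡ suc (rangeValue (assign k))
  label-edgeKinds k =
    cong suc (trans (cong (toℕ ∘ Inverse.to labelRanges ∘ assign) (Inverse.strictlyInverseʳ edgeKinds k))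
                    (toℕ-labelRanges (assign k)))

  label-matchEdge : ∀ i → label labelling (matchEdge i) ≡ suc (m * a + toℕ i)
  label-matchEdge i = label-edgeKinds (inj₁ i)

  label-uwEdge : ∀ i j → label labelling (uwEdge i j) ≡ suc (toℕ (column i j))
  label-uwEdge i j = label-edgeKinds (inj₂ (inj₁ i , j))

  label-vwEdge : ∀ i j →
                 label labelling (vwEdge i j) ≡ suc (m * a + (a + toℕ (opposite (column (opposite i) j))))
  label-vwEdge i j = label-edgeKinds (inj₂ (inj₂ i , j))

  label-uwEdge+vwEdge : ∀ i j →
                        label labelling (uwEdge (opposite i) j) + label labelling (vwEdge i j) ≡ suc Q
  label-uwEdge+vwEdge i j = begin
    label labelling (uwEdge (opposite i) j) + label labelling (vwEdge i j)
      ≡⟨ cong₂ _+_ (label-uwEdge (opposite i) j) (label-vwEdge i j) ⟩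
    suc (toℕ c) + suc (m * a + (a + toℕ (opposite c)))
      ≡⟨ regroup (toℕ c) (m * a) a (toℕ (opposite c)) ⟩
    suc (m * a + (a + (toℕ (opposite c) + suc (toℕ c))))
      ≡⟨ cong (λ s → suc (m * a + (a + s))) (toℕ-opposite+suc c) ⟩
    suc (m * a + (a + m * a))
      ≡⟨ cong suc Q≡ ⟩
    suc Q ∎
    where
    c : Fin (m * a)
    c = column (opposite i) j
    regroup : ∀ x y z w → suc x + suc (y + (z + w)) ≡ suc (y + (z + (w + suc x)))
    regroup = solve-∀

  label-matchEdge+matchEdge : ∀ i →
                              label labelling (matchEdge (opposite i)) + label labelling (matchEdge i) ≡ suc Q
  label-matchEdge+matchEdge i = begin
    label labelling (matchEdge (opposite i)) + label labelling (matchEdge i)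
      ≡⟨ cong₂ _+_ (label-matchEdge (opposite i)) (label-matchEdge i) ⟩
    suc (m * a + toℕ (opposite i)) + suc (m * a + toℕ i)
      ≡⟨ regroup (m * a) (toℕ (opposite i)) (toℕ i) ⟩
    suc (m * a + (toℕ (opposite i) + suc (toℕ i) + m * a))
      ≡⟨ cong (λ s → suc (m * a + (s + m * a))) (toℕ-opposite+suc i) ⟩
    suc (m * a + (a + m * a))
      ≡⟨ cong suc Q≡ ⟩
    suc Q ∎
    where
    regroup : ∀ x y z → suc (x + y) + suc (x + z) ≡ suc (x + (y + suc z + x))
    regroup = solve-∀

  vsum-w-labelling : ∀ j → vsum labelling (w j) ≡ wSum a n
  vsum-w-labelling j = begin
    vsum labelling (w j)
      ≡⟨ vsum-w labelling j ⟩
    ∑[ i < a ] ℓ (uwEdge i j) + ∑[ i < a ] ℓ (vwEdge i j)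
      ≡⟨ cong (_+ ∑[ i < a ] ℓ (vwEdge i j)) (sym (∑-opposite (λ i → ℓ (uwEdge i j)))) ⟩
    ∑[ i < a ] ℓ (uwEdge (opposite i) j) + ∑[ i < a ] ℓ (vwEdge i j)
      ≡⟨ sym (∑-distrib-+ {a} (λ i → ℓ (uwEdge (opposite i) j)) (λ i → ℓ (vwEdge i j))) ⟩
    ∑[ i < a ] (ℓ (uwEdge (opposite i) j) + ℓ (vwEdge i j))
      ≡⟨ sum-cong-≗ (λ i → label-uwEdge+vwEdge i j) ⟩
    ∑[ i < a ] suc Q
      ≡⟨ ∑-const a (suc Q) ⟩
    a * suc Q ∎
    where
    ℓ : Fin Q → ℕ
    ℓ = label labelling

  vsum-u+vsum-v : ∀ i → vsum labelling (u (opposite i)) + vsum labelling (v i) ≡ suc m * suc Q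
  vsum-u+vsum-v i = begin
    vsum labelling (u (opposite i)) + vsum labelling (v i)
      ≡⟨ cong₂ _+_ (vsum-u labelling (opposite i)) (vsum-v labelling i) ⟩
    (ℓ (matchEdge (opposite i)) + U) + (ℓ (matchEdge i) + W)
      ≡⟨ regroup (ℓ (matchEdge (opposite i))) U (ℓ (matchEdge i)) W ⟩
    (ℓ (matchEdge (opposite i)) + ℓ (matchEdge i)) + (U + W)
      ≡⟨ cong₂ _+_ (label-matchEdge+matchEdge i) (sym (∑-distrib-+ {m} _ _)) ⟩
    suc Q + ∑[ j < m ] (ℓ (uwEdge (opposite i) j) + ℓ (vwEdge i j))
      ≡⟨ cong (suc Q +_) (trans (sum-cong-≗ (label-uwEdge+vwEdge i)) (∑-const m (suc Q))) ⟩
    suc m * suc Q ∎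
    where
    ℓ : Fin Q → ℕ
    ℓ = label labelling
    U W : ℕ
    U = ∑[ j < m ] ℓ (uwEdge (opposite i) j)
    W = ∑[ j < m ] ℓ (vwEdge i j)
    regroup : ∀ x y z t → (x + y) + (z + t) ≡ (x + z) + (y + t)
    regroup = solve-∀

  ∑-column : ∀ i →
             ∑[ j < m ] suc (toℕ (column i j)) ≡ m + (a * (n * m) + (suc n * toℕ (opposite i) + n * toℕ i))
  ∑-column i = begin
    ∑[ j < m ] suc (toℕ (column i j))
      ≡⟨ sum-cong-≗ {m} (λ j → cong suc (toℕ-combine j (twist (parity (toℕ j)) i))) ⟩
    ∑[ j < m ] (1 + (a * toℕ j + g (parity (toℕ j))))
      ≡⟨ ∑-distrib-+ {m} (λ _ → 1) _ ⟩
    ∑[ j < m ] 1 + ∑[ j < m ] (a * toℕ j + g (parity (toℕ j)))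
      ≡⟨ cong₂ _+_ (trans (∑-const m 1) (*-identityʳ m)) (∑-distrib-+ {m} _ _) ⟩
    m + (∑[ j < m ] (a * toℕ j) + ∑[ j < m ] g (parity (toℕ j)))
      ≡⟨ cong (m +_) (cong₂ _+_ (trans (sym (*-distribˡ-sum {m} a toℕ)) (cong (a *_) (∑-toℕ-odd n)))
                                (∑-parity n g)) ⟩
    m + (a * (n * m) + (suc n * toℕ (opposite i) + n * toℕ i)) ∎
    where
    g : Parity → ℕ
    g p = toℕ (twist p i)

  vsum-u-labelling : ∀ i → vsum labelling (u i) ≡ uSum a n
  vsum-u-labelling i = begin
    vsum labelling (u i)
      ≡⟨ vsum-u labelling i ⟩
    label labelling (matchEdge i) + ∑[ j < m ] label labelling (uwEdge i j)
      ≡⟨ cong₂ _+_ (label-matchEdge i) (trans (sum-cong-≗ (label-uwEdge i)) (∑-column i)) ⟩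
    suc (m * a + toℕ i) + (m + (a * (n * m) + (suc n * toℕ (opposite i) + n * toℕ i)))
      ≡⟨ subst (λ a′ → suc (m * a′ + toℕ i) + (m + (a′ * (n * m) + (suc n * toℕ (opposite i) + n * toℕ i)))
                       ≡ uSum a′ n)
               (toℕ-opposite+suc i) (rowSum n (toℕ (opposite i)) (toℕ i)) ⟩
    uSum a n ∎
    where
    -- Writing a as toℕ (opposite i) + suc (toℕ i) turns this step into a ring identity.
    rowSum : ∀ n o x → let a′ = o + suc x; m = 2 * n + 1 in
             suc (m * a′ + x) + (m + (a′ * (n * m) + (suc n * o + n * x))) ≡ suc n * (2 * (a′ * suc n) + 1)
    rowSum = solve-∀

  vsum-v-labelling : ∀ i → vsum labelling (v i) ≡ vSum a n
  vsum-v-labelling i = +-cancelˡ-≡ (uSum a n) _ _ (begin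
    uSum a n + vsum labelling (v i)
      ≡⟨ cong (_+ vsum labelling (v i)) (sym (vsum-u-labelling (opposite i))) ⟩
    vsum labelling (u (opposite i)) + vsum labelling (v i)
      ≡⟨ vsum-u+vsum-v i ⟩
    suc m * suc Q
      ≡⟨ uSum+vSum a n ⟩
    uSum a n + vSum a n ∎)
    where
    uSum+vSum : ∀ a n → suc (2 * n + 1) * suc (a + (a + a) * (2 * n + 1))
                        ≡ suc n * (2 * (a * suc n) + 1) + suc n * (2 * (a * (3 * n + 2)) + 1)
    uSum+vSum = solve-∀

  labelling-antimagic : uSum a n ≢ vSum a n → uSum a n ≢ wSum a n → vSum a n ≢ wSum a n →
                        IsLocalAntimagic labelling
  labelling-antimagic u≢v u≢w v≢w = edge-elim _
    (λ i   → separated (ends-matchEdge i) (vsum-u-labelling i) (vsum-v-labelling i) u≢v)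
    (λ i j → separated (ends-uwEdge i j)  (vsum-u-labelling i) (vsum-w-labelling j) u≢w)
    (λ i j → separated (ends-vwEdge i j)  (vsum-v-labelling i) (vsum-w-labelling j) v≢w)
    where
    separated : ∀ {e x y s t} → ends G e ≡ (x , y) → vsum labelling x ≡ s → vsum labelling y ≡ t → s ≢ t →
                ¬ vsum labelling (proj₁ (ends G e)) ≡ vsum labelling (proj₂ (ends G e))
    separated ends≡ x≡s y≡t s≢t = antimagic-at labelling ends≡ (subst₂ _≢_ (sym x≡s) (sym y≡t) s≢t)

  distinctSums-labelling≤3 : distinctSums labelling ≤ 3
  distinctSums-labelling≤3 =
    distinctSums≤length labelling {uSum a n ∷ vSum a n ∷ wSum a n ∷ []} (vertex-elim _
      (λ i → here (vsum-u-labelling i))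
      (λ i → there (here (vsum-v-labelling i)))
      (λ j → there (there (here (vsum-w-labelling j)))))

theorem3p1 : (n k : ℕ) → 1 ≤ n → 1 ≤ k →
    χla≡ (join (copiesP2 (2 * k + 1)) (nullGraph (2 * n + 1))) 3
theorem3p1 n k _ _ =
  (labelling , antimagic , ≤-antisym distinctSums-labelling≤3 (3≤distinctSums i₀ j₀ labelling antimagic)) ,
  3≤distinctSums i₀ j₀
  where
  open MatchingJoinNull (2 * k + 1) (2 * n + 1)
  open Labelling (2 * k + 1) n
  antimagic : IsLocalAntimagic labelling
  antimagic = labelling-antimagic (<⇒≢ (uSum<vSum k n)) (uSum≢wSum k n) (vSum≢wSum k n)
  i₀ : Fin (2 * k + 1)
  i₀ = fromℕ< (m≤n+m 1 (2 * k))
  j₀ : Fin (2 * n + 1)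
  j₀ = fromℕ< (m≤n+m 1 (2 * n))
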